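{- For every $n\ge1$, the set $Q_n^{(2)}=\{\pi\in S_n: |q^{ -1}(\pi)|=2\}$ equals the set of $\pi\in S_n$ such that $\pi_n=n$, $\pi_1$ and $\pi_2$ are both LTR maxima, and there is no index $i\ge2$ with both $\pi_i$ and $\pi_{i+1}$ LTR maxima. Consequently $q_n^{(2)}=|Q_n^{(2)}|$ satisfies $q_0^{(2)}=q_1^{(2)}=q_3^{(2)}=0$, $q_2^{(2)}=1$ and \[q_{n+1}^{(2)}=(n-1)q_n^{(2)}+(n-1)q_{n-1}^{(2)}\qquad (n\ge3).\]
   Context: $S_n$ is the set of permutations of $\{1,\dots,n\}$ in one-line notation $\pi=\pi_1\cdots\pi_n$. An entry $\pi_i$ is a left-to-right (LTR) maximum if $\pi_i>\pi_j$ for all $j<i$. The map $q:S_n\to S_n$ (the algorithm Queuesort, sorting with a queue allowing bypass) is described as follows: let $m_1,\dots,m_r$ be the LTR maxima of $\pi$ from left to right; for $i=r,r-1,\dots,1$ in this order, repeatedly swap $m_i$ with the entry immediately to its right as long as such an entry exists and is smaller than $m_i$; the result is $q(\pi)$ (e.g. $q(21543)=12435$). $q^{ -1}(\pi)=\{\sigma\in S_n:q(\sigma)=\pi\}$. -}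

module Defs where

open import Data.Nat using (ℕ; zero; suc; _<_; _≤_; _<ᵇ_; _≡ᵇ_)
open import Data.Nat.Properties using (_≟_)
open import Data.Bool using (Bool; true; false; if_then_else_)
open import Data.List using (List; []; _∷_; map; upTo; foldr; length)
open import Data.List.Membership.Propositional using (_∈_)
open import Data.List.Relation.Unary.Unique.Propositional using (Unique)
open import Data.List.Relation.Binary.Permutation.Propositional using (_↭_)
open import Data.Maybe using (Maybe; just; nothing)
open import Data.Product using (Σ; _×_; ∃)
open import Data.Sum using (_⊎_)
open import Relation.Binary.PropositionalEquality using (_≡_)
open import Relation.Nullary using (¬_)
open import Function.Bundles using (_⇔_)

-- Permutations of {1,…,n} in one-line notation: lists that are a
-- rearrangement of [1,2,…,n].
IsPerm : ℕ → List ℕ → Set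
IsPerm n σ = σ ↭ map suc (upTo n)

-- Values of the left-to-right maxima, from left to right.
-- (Entries are ≥ 1, so the running maximum starts at 0.)
ltrMaxGo : ℕ → List ℕ → List ℕ
ltrMaxGo mx [] = []
ltrMaxGo mx (x ∷ xs) = if mx <ᵇ x then x ∷ ltrMaxGo x xs else ltrMaxGo mx xs

ltrMaxima : List ℕ → List ℕ
ltrMaxima = ltrMaxGo 0

push : ℕ → List ℕ → List ℕ
push m [] = m ∷ []
push m (y ∷ ys) = if y <ᵇ m then y ∷ push m ys else m ∷ y ∷ ys

bubble : ℕ → List ℕ → List ℕ
bubble m [] = []
bubble m (x ∷ xs) = if x ≡ᵇ m then push m xs else x ∷ bubble m xs

-- Queuesort: process LTR maxima m_r, m_{r-1}, …, m_1 in this order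
-- (foldr applies the last element of the list first).
q : List ℕ → List ℕ
q σ = foldr bubble σ (ltrMaxima σ)

-- 1-based indexing: π at i = just π_i if 1 ≤ i ≤ length π
_at_ : List ℕ → ℕ → Maybe ℕ
[] at i = nothing
(x ∷ xs) at zero = nothing
(x ∷ xs) at suc zero = just x
(x ∷ xs) at suc (suc i) = xs at suc i

IsLTRMax : List ℕ → ℕ → Set
IsLTRMax π i = Σ ℕ λ v → (π at i ≡ just v) ×
  (∀ j w → 1 ≤ j → j < i → π at j ≡ just w → w < v)

HasTwoPreimages : ℕ → List ℕ → Set
HasTwoPreimages n π = Σ (List ℕ) λ σ₁ → Σ (List ℕ) λ σ₂ →
  IsPerm n σ₁ × IsPerm n σ₂ × ¬ (σ₁ ≡ σ₂) × q σ₁ ≡ π × q σ₂ ≡ π ×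
  (∀ σ → IsPerm n σ → q σ ≡ π → (σ ≡ σ₁ ⊎ σ ≡ σ₂))

Q2 : ℕ → List ℕ → Set
Q2 n π = IsPerm n π × HasTwoPreimages n π

Char : ℕ → List ℕ → Set
Char n π = IsPerm n π × (π at n ≡ just n) × IsLTRMax π 1 × IsLTRMax π 2 ×
  (∀ i → 2 ≤ i → ¬ (IsLTRMax π i × IsLTRMax π (suc i)))

HasCard : (List ℕ → Set) → ℕ → Set
HasCard P c = Σ (List (List ℕ)) λ l → (length l ≡ c) × Unique l × (∀ x → (x ∈ l) ⇔ P x)

-- Write σ = m B σ′ with B the maximal run of entries smaller than m after m.
-- The LTR maxima of σ are m and those of σ′, so q(σ) = B · push_m(q σ′), where
-- push_m moves m to the right past smaller entries. Hence q(σ) ends with n, and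
-- either m travels to the end or it stops right before a larger entry y; then m y
-- are adjacent LTR maxima of q(σ) with only smaller entries before them.
-- If π = P m R n with P < m < (R n)₁ and P nonempty, then n P m R, m n P R and
-- m P n R are three preimages of π. So |q⁻¹(π)| = 2 forces π to end with n and
-- to have no adjacent LTR maxima after position 1, and π₁ < π₂ because one of two
-- distinct preimages must stop its first entry. Conversely, for such π = a W n
-- the preimages are exactly n a W and a n W.
-- For the count, delete the last entry of a permutation of 1, …, n + 1 and
-- standardize. Call π good if π₁, π₂ are LTR maxima and no later pair of
-- adjacent entries are. The good permutations of length n + 1 ending with n + 1
-- come from the good ones of length n not ending with n, and those ending with
-- v ≤ n from all good ones of length n, once for each v.
-- With x_n, y_n the two kinds of good permutations of length n, this gives
-- x_{n+1} = y_n and y_{n+1} = n (x_n + y_n), and q_n^{(2)} = x_n.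

module Submission where

open import Defs
open import Data.Nat using (ℕ; zero; suc; _≤_; _<_; _+_; _*_; _∸_; z≤n; s≤s; _<ᵇ_)
open import Data.Nat.Properties
open import Data.Bool using (true; false; if_then_else_)
open import Data.Unit using (⊤; tt)
open import Data.Empty using (⊥; ⊥-elim)
open import Data.List using (List; []; _∷_; _++_; map; upTo; foldr; length; [_]; cartesianProductWith; _∷ʳ′_; initLast)
open import Data.List.Properties
  using (++-assoc; ++-identityʳ; length-++; length-map; length-upTo; map-injective; ∷-injective; ∷ʳ-injective; ∷ʳ-injectiveʳ)
open import Data.List.Relation.Unary.All as All using (All; []; _∷_; lookup; tabulate)
import Data.List.Relation.Unary.All.Properties as All
open import Data.List.Membership.Propositional using (_∈_)
open import Data.List.Membership.Propositional.Properties
  using (∈-++⁺ˡ; ∈-++⁺ʳ; ∈-++⁻; ∈-map⁺; ∈-map⁻; ∈-upTo⁺; ∈-upTo⁻; ∈-cartesianProductWith⁺; ∈-cartesianProductWith⁻)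
open import Data.List.Membership.Propositional.Properties.WithK using (unique∧set⇒bag)
open import Data.List.Relation.Unary.Any using (here; there)
open import Data.List.Relation.Unary.Unique.Propositional using (Unique; []; _∷_)
import Data.List.Relation.Unary.Unique.Propositional.Properties as Unique
open import Data.List.Relation.Binary.Permutation.Propositional using (_↭_; ↭-refl; ↭-sym; ↭-trans; prep; swap; ↭⇒↭ₛ)
open import Data.List.Relation.Binary.Permutation.Propositional.Properties using (∈-resp-↭; ↭-length; ↭-empty-inv; All-resp-↭)
import Data.List.Relation.Binary.Permutation.Setoid.Properties as Perm
open import Data.List.Relation.Binary.BagAndSetEquality using (∼bag⇒↭)
open import Data.Maybe using (just)
import Data.Maybe as Maybe
open import Data.Product using (_×_; Σ; _,_; proj₁; proj₂)
open import Data.Sum using (_⊎_; inj₁; inj₂)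
import Data.Sum as Sum
open import Relation.Binary.Definitions using (tri<; tri≈; tri>)
open import Relation.Binary.PropositionalEquality
  using (_≡_; _≢_; refl; sym; trans; cong; cong₂; subst; subst₂; setoid; module ≡-Reasoning)
open import Relation.Nullary using (¬_; Dec; yes; no)
open import Relation.Nullary.Decidable using (dec-true; dec-false)
open import Function.Base using (_∘_)
open import Function.Bundles using (_⇔_; mk⇔; Equivalence)

-- Queuesort on a block decomposition

HeadAbove : ℕ → List ℕ → Set
HeadAbove m []      = ⊤
HeadAbove m (y ∷ _) = m < y

-- `does (m <? n)` and `does (m ≟ n)` compute to `m <ᵇ n` and `m ≡ᵇ n`,
-- so `dec-true`/`dec-false` evaluate the tests inside `push` and `bubble`.
push-++ : ∀ m B τ → All (_< m) B → push m (B ++ τ) ≡ B ++ push m τ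
push-++ m []      τ []          = refl
push-++ m (b ∷ B) τ (b<m ∷ B<m) rewrite dec-true (b <? m) b<m = cong (b ∷_) (push-++ m B τ B<m)

push-headAbove : ∀ {m} τ → HeadAbove m τ → push m τ ≡ m ∷ τ
push-headAbove     []      _   = refl
push-headAbove {m} (y ∷ E) m<y rewrite dec-false (y <? m) (<⇒≯ m<y) = refl

bubble-++ : ∀ x pre τ → All (_< x) pre → bubble x (pre ++ τ) ≡ pre ++ bubble x τ
bubble-++ x []        τ []          = refl
bubble-++ x (p ∷ pre) τ (p<x ∷ pre<x)
  rewrite dec-false (p ≟ x) (<⇒≢ p<x) = cong (p ∷_) (bubble-++ x pre τ pre<x)

bubble-head : ∀ m τ → bubble m (m ∷ τ) ≡ push m τ
bubble-head m τ rewrite dec-true (m ≟ m) refl = refl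

foldr-bubble-++ : ∀ {mx} pre τ L → All (mx <_) L → All (_≤ mx) pre →
                  foldr bubble (pre ++ τ) L ≡ pre ++ foldr bubble τ L
foldr-bubble-++ pre τ []      []           pre≤mx = refl
foldr-bubble-++ pre τ (x ∷ L) (mx<x ∷ mx<L) pre≤mx = begin
  bubble x (foldr bubble (pre ++ τ) L)  ≡⟨ cong (bubble x) (foldr-bubble-++ pre τ L mx<L pre≤mx) ⟩
  bubble x (pre ++ foldr bubble τ L)    ≡⟨ bubble-++ x pre _ (All.map (λ p≤mx → ≤-<-trans p≤mx mx<x) pre≤mx) ⟩
  pre ++ bubble x (foldr bubble τ L)    ∎
  where open ≡-Reasoning

ltrMaxGo-++ : ∀ mx B τ → All (_≤ mx) B → ltrMaxGo mx (B ++ τ) ≡ ltrMaxGo mx τ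
ltrMaxGo-++ mx []      τ []           = refl
ltrMaxGo-++ mx (b ∷ B) τ (b≤mx ∷ B≤mx) rewrite dec-false (mx <? b) (≤⇒≯ b≤mx) = ltrMaxGo-++ mx B τ B≤mx

ltrMaxGo-> : ∀ mx τ → All (mx <_) (ltrMaxGo mx τ)
ltrMaxGo-> mx []      = []
ltrMaxGo-> mx (x ∷ τ) with mx <? x
... | yes mx<x rewrite dec-true (mx <? x) mx<x = mx<x ∷ All.map (<-trans mx<x) (ltrMaxGo-> x τ)
... | no  mx≮x rewrite dec-false (mx <? x) mx≮x = ltrMaxGo-> mx τ

ltrMaxGo-headAbove : ∀ m τ → HeadAbove m τ → ltrMaxGo m τ ≡ ltrMaxima τ
ltrMaxGo-headAbove m []      _   = refl
ltrMaxGo-headAbove m (y ∷ τ) m<y rewrite dec-true (m <? y) m<y | dec-true (0 <? y) (≤-<-trans z≤n m<y) = refl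

-- The LTR maxima of m B σ′ are m followed by those of σ′, all above m, so
-- bubbling them never enters the prefix m B; m itself is processed last.
q-block : ∀ m B σ′ → 0 < m → All (_< m) B → HeadAbove m σ′ → q (m ∷ B ++ σ′) ≡ B ++ push m (q σ′)
q-block m B σ′ 0<m B<m m<σ′ = begin
  foldr bubble (m ∷ B ++ σ′) (ltrMaxima (m ∷ B ++ σ′))  ≡⟨ cong (foldr bubble (m ∷ B ++ σ′)) ltrMaxima-block ⟩
  bubble m (foldr bubble ((m ∷ B) ++ σ′) (ltrMaxima σ′))
    ≡⟨ cong (bubble m) (foldr-bubble-++ (m ∷ B) σ′ _ m<ltrMaxima (≤-refl ∷ B≤m)) ⟩
  bubble m (m ∷ B ++ q σ′)                              ≡⟨ bubble-head m (B ++ q σ′) ⟩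
  push m (B ++ q σ′)                                    ≡⟨ push-++ m B (q σ′) B<m ⟩
  B ++ push m (q σ′)                                    ∎
  where
  open ≡-Reasoning
  B≤m : All (_≤ m) B
  B≤m = All.map <⇒≤ B<m
  ltrMaxima-block : ltrMaxima (m ∷ B ++ σ′) ≡ m ∷ ltrMaxima σ′
  ltrMaxima-block rewrite dec-true (0 <? m) 0<m | ltrMaxGo-++ m B σ′ B≤m = cong (m ∷_) (ltrMaxGo-headAbove m σ′ m<σ′)
  m<ltrMaxima : All (m <_) (ltrMaxima σ′)
  m<ltrMaxima = subst (All (m <_)) (ltrMaxGo-headAbove m σ′ m<σ′) (ltrMaxGo-> m σ′)

q-last : ∀ n I → 0 < n → All (_< n) I → q (n ∷ I) ≡ I ++ [ n ]
q-last n I 0<n I<n = subst (λ t → q (n ∷ t) ≡ I ++ [ n ]) (++-identityʳ I) (q-block n I [] 0<n I<n tt)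

record Block (m : ℕ) (rest : List ℕ) : Set where
  constructor block
  field
    front back : List ℕ
    rest≡      : rest ≡ front ++ back
    front<m    : All (_< m) front
    m<back     : HeadAbove m back

block-split : ∀ m rest → All (m ≢_) rest → Block m rest
block-split m []       _              = block [] [] refl [] tt
block-split m (y ∷ ys) (m≢y ∷ m≢ys) with m <? y | block-split m ys m≢ys
... | yes m<y | _ = block [] (y ∷ ys) refl [] m<y
... | no  m≮y | block B σ′ refl B<m m<σ′ =
  block (y ∷ B) σ′ refl (≤∧≢⇒< (≮⇒≥ m≮y) (m≢y ∘ sym) ∷ B<m) m<σ′

push-↭ : ∀ m τ → push m τ ↭ m ∷ τ
push-↭ m []       = ↭-refl
push-↭ m (y ∷ ys) with y <ᵇ m
... | true  = ↭-trans (prep y (push-↭ m ys)) (swap y m ↭-refl)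
... | false = ↭-refl

bubble-↭ : ∀ m τ → bubble m τ ↭ τ
bubble-↭ m []       = ↭-refl
bubble-↭ m (x ∷ xs) with x ≟ m
... | yes refl rewrite dec-true (x ≟ x) refl = push-↭ x xs
... | no  x≢m  rewrite dec-false (x ≟ m) x≢m = prep x (bubble-↭ m xs)

q-↭ : ∀ σ → q σ ↭ σ
q-↭ σ = foldr-↭ (ltrMaxima σ)
  where
  foldr-↭ : ∀ L → foldr bubble σ L ↭ σ
  foldr-↭ []      = ↭-refl
  foldr-↭ (x ∷ L) = ↭-trans (bubble-↭ x _) (foldr-↭ L)

∈-q⁺ : ∀ {y} σ → y ∈ σ → y ∈ q σ
∈-q⁺ σ = ∈-resp-↭ (↭-sym (q-↭ σ))

∉-q⁺ : ∀ {m} σ → All (m ≢_) σ → All (m ≢_) (q σ)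
∉-q⁺ σ = All-resp-↭ (↭-sym (q-↭ σ))

-- Images of Queuesort

Unique-++⁻ˡ : ∀ (I : List ℕ) {J} → Unique (I ++ J) → Unique I
Unique-++⁻ˡ []      _          = []
Unique-++⁻ˡ (i ∷ I) (i∉ ∷ u) = All.++⁻ˡ I i∉ ∷ Unique-++⁻ˡ I u

Unique-++⁻ʳ : ∀ (B : List ℕ) {σ} → Unique (B ++ σ) → Unique σ
Unique-++⁻ʳ []      u       = u
Unique-++⁻ʳ (b ∷ B) (_ ∷ u) = Unique-++⁻ʳ B u

EndsWithMax : ℕ → List ℕ → Set
EndsWithMax M τ = Σ (List ℕ) λ J → τ ≡ J ++ [ M ] × All (_< M) J

endsWithMax-≤ : ∀ {M τ y} → EndsWithMax M τ → y ∈ τ → y ≤ M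
endsWithMax-≤ (J , refl , J<M) y∈ with ∈-++⁻ J y∈
... | inj₁ y∈J         = <⇒≤ (lookup J<M y∈J)
... | inj₂ (here refl) = ≤-refl

++-endsWithMax : ∀ {M τ} B → All (_< M) B → EndsWithMax M τ → EndsWithMax M (B ++ τ)
++-endsWithMax {M} B B<M (J , refl , J<M) = B ++ J , sym (++-assoc B J [ M ]) , All.++⁺ B<M J<M

push-endsWithMax : ∀ {m M τ} → m < M → EndsWithMax M τ → EndsWithMax M (push m τ)
push-endsWithMax {m} {M} m<M (J , refl , J<M) = go J J<M
  where
  go : ∀ J → All (_< M) J → EndsWithMax M (push m (J ++ [ M ]))
  go []      []          rewrite dec-false (M <? m) (<⇒≯ m<M) = m ∷ [] , refl , m<M ∷ []
  go (j ∷ J) (j<M ∷ J<M) with j <ᵇ m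
  ... | false = m ∷ j ∷ J , refl , m<M ∷ j<M ∷ J<M
  ... | true  = ++-endsWithMax (j ∷ []) (j<M ∷ []) (go J J<M)

length-≤-++ : ∀ (B : List ℕ) {σ} → length σ ≤ length (B ++ σ)
length-≤-++ B {σ} = subst (length σ ≤_) (sym (length-++ B)) (m≤n+m (length σ) (length B))

-- Fuel on the length: `q-block` recurses into a suffix, not a subterm.
q-endsWithMax : ∀ k σ → length σ ≤ k → Unique σ → All (0 <_) σ → σ ≢ [] → Σ ℕ λ M → EndsWithMax M (q σ)
q-endsWithMax k       []         _         _        _           σ≢[] = ⊥-elim (σ≢[] refl)
q-endsWithMax (suc k) (m ∷ rest) (s≤s len) (m∉ ∷ u) (0<m ∷ pos) _ with block-split m rest m∉
... | block B [] refl B<m _ = m , B , q-block m B [] 0<m B<m tt , B<m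
... | block B σ′@(y ∷ ys) refl B<m m<y
  with q-endsWithMax k σ′ (≤-trans (length-≤-++ B) len) (Unique-++⁻ʳ B u) (All.++⁻ʳ B pos) (λ ())
... | M , qσ′ = M , subst (EndsWithMax M) (sym (q-block m B σ′ 0<m B<m m<y))
                        (++-endsWithMax B (All.map (λ b<m → <-trans b<m m<M) B<m) (push-endsWithMax m<M qσ′))
  where m<M = <-≤-trans m<y (endsWithMax-≤ qσ′ (∈-q⁺ σ′ (here refl)))

push-stops : ∀ {m y₀} τ → All (m ≢_) τ → y₀ ∈ τ → m < y₀ →
  Σ (List ℕ) λ C → Σ ℕ λ y → Σ (List ℕ) λ E → push m τ ≡ C ++ m ∷ y ∷ E × All (_< m) C × m < y
push-stops {m} (z ∷ τ) (m≢z ∷ m∉τ) y₀∈ m<y₀ with z <? m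
... | no z≮m rewrite dec-false (z <? m) z≮m = [] , z , τ , refl , [] , ≤∧≢⇒< (≮⇒≥ z≮m) m≢z
... | yes z<m rewrite dec-true (z <? m) z<m with y₀∈
...   | here refl   = ⊥-elim (<-asym z<m m<y₀)
...   | there y₀∈τ with push-stops τ m∉τ y₀∈τ m<y₀
...     | C , y , E , eq , C<m , m<y = z ∷ C , y , E , cong (z ∷_) eq , z<m ∷ C<m , m<y

push-fixed : ∀ {m τ} τ′ → All (m ≢_) τ′ → push m τ′ ≡ m ∷ τ → τ′ ≡ τ
push-fixed []       _           refl = refl
push-fixed {m} (y ∷ ys) (m≢y ∷ _) eq with y <ᵇ m
... | true  = ⊥-elim (m≢y (sym (proj₁ (∷-injective eq))))
... | false = proj₂ (∷-injective eq)

-- In the second case m and y are adjacent LTR maxima of the image.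
data HeadCase (m : ℕ) (rest : List ℕ) : Set where
  goesLast    : q (m ∷ rest) ≡ rest ++ [ m ] → HeadCase m rest
  stopsBefore : ∀ P y E → q (m ∷ rest) ≡ P ++ m ∷ y ∷ E → All (_< m) P → m < y → HeadCase m rest

headCase : ∀ m rest → Unique (m ∷ rest) → All (0 <_) (m ∷ rest) → HeadCase m rest
headCase m rest (m∉ ∷ _) (0<m ∷ _) with block-split m rest m∉
... | block B [] refl B<m _ =
  goesLast (trans (q-block m B [] 0<m B<m tt) (cong (_++ [ m ]) (sym (++-identityʳ B))))
... | block B σ′@(y₀ ∷ _) refl B<m m<y₀
  with push-stops (q σ′) (∉-q⁺ σ′ (All.++⁻ʳ B m∉)) (∈-q⁺ σ′ (here refl)) m<y₀
... | C , y , E , eq , C<m , m<y =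
  stopsBefore (B ++ C) y E (trans (q-block m B σ′ 0<m B<m m<y₀) (trans (cong (B ++_) eq) (sym (++-assoc B C _))))
    (All.++⁺ B<m C<m) m<y

q-headFixed : ∀ {m rest τ} → Unique (m ∷ rest) → All (0 <_) (m ∷ rest) → q (m ∷ rest) ≡ m ∷ τ → q rest ≡ τ
q-headFixed {m} {rest} (m∉ ∷ _) (0<m ∷ _) eq with block-split m rest m∉
... | block (b ∷ B) σ′ refl (b<m ∷ B<m) m<σ′ =
  ⊥-elim (<-irrefl (proj₁ (∷-injective (trans (sym (q-block m (b ∷ B) σ′ 0<m (b<m ∷ B<m) m<σ′)) eq))) b<m)
... | block [] σ′ refl [] m<σ′ =
  push-fixed (q σ′) (∉-q⁺ σ′ m∉) (trans (sym (q-block m [] σ′ 0<m [] m<σ′)) eq)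

-- Positions and left-to-right maxima

at-++ˡ : ∀ (xs ys : List ℕ) k → k < length xs → (xs ++ ys) at suc k ≡ xs at suc k
at-++ˡ (x ∷ xs) ys zero    _         = refl
at-++ˡ (x ∷ xs) ys (suc k) (s≤s k<n) = at-++ˡ xs ys k k<n

at-middle : ∀ (P : List ℕ) m R → (P ++ m ∷ R) at suc (length P) ≡ just m
at-middle []      m R = refl
at-middle (p ∷ P) m R = at-middle P m R

at-∈ : ∀ (xs : List ℕ) k {w} → xs at suc k ≡ just w → w ∈ xs
at-∈ (x ∷ xs) zero    refl = here refl
at-∈ (x ∷ xs) (suc k) eq   = there (at-∈ xs k eq)

at-< : ∀ (xs : List ℕ) k {w} → xs at suc k ≡ just w → k < length xs
at-< (x ∷ xs) zero    _  = s≤s z≤n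
at-< (x ∷ xs) (suc k) eq = s≤s (at-< xs k eq)

∈⇒at : ∀ {w} (xs : List ℕ) → w ∈ xs → Σ ℕ λ k → k < length xs × xs at suc k ≡ just w
∈⇒at (x ∷ xs) (here refl) = zero , s≤s z≤n , refl
∈⇒at (x ∷ xs) (there w∈) with ∈⇒at xs w∈
... | k , k< , eq = suc k , s≤s k< , eq

at-split : ∀ (xs : List ℕ) k {w} → xs at suc k ≡ just w →
           Σ (List ℕ) λ P → Σ (List ℕ) λ R → xs ≡ P ++ w ∷ R × length P ≡ k
at-split (x ∷ xs) zero    refl = [] , xs , refl , refl
at-split (x ∷ xs) (suc k) eq with at-split xs k eq
... | P , R , refl , refl = x ∷ P , R , refl , refl

at-map : ∀ (f : ℕ → ℕ) xs i → map f xs at i ≡ Maybe.map f (xs at i)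
at-map f []       i             = refl
at-map f (x ∷ xs) zero          = refl
at-map f (x ∷ xs) (suc zero)    = refl
at-map f (x ∷ xs) (suc (suc i)) = at-map f xs (suc i)

map-just⁻ : ∀ {f : ℕ → ℕ} {m w} → Maybe.map f m ≡ just w → Σ ℕ λ u → m ≡ just u × f u ≡ w
map-just⁻ {m = just u} refl = u , refl , refl

snoc-view : ∀ (xs : List ℕ) → xs ≢ [] → Σ (List ℕ) λ R → Σ ℕ λ z → xs ≡ R ++ [ z ]
snoc-view xs xs≢[] with initLast xs
... | []      = ⊥-elim (xs≢[] refl)
... | R ∷ʳ′ z = R , z , refl

length-snoc : ∀ (I : List ℕ) x → length (I ++ [ x ]) ≡ suc (length I)
length-snoc I x = trans (length-++ I) (+-comm (length I) 1)

at-last⁻ : ∀ (xs : List ℕ) k {v} → length xs ≡ suc k → xs at suc k ≡ just v →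
           Σ (List ℕ) λ I → xs ≡ I ++ [ v ] × length I ≡ k
at-last⁻ (x ∷ [])     zero    refl refl = [] , refl , refl
at-last⁻ (x ∷ y ∷ xs) zero    ()   _
at-last⁻ (x ∷ xs)     (suc k) len  eq with at-last⁻ xs k (suc-injective len) eq
... | I , refl , refl = x ∷ I , refl , refl

ltrMax-0 : ∀ xs → ¬ IsLTRMax xs 0
ltrMax-0 []      (_ , () , _)
ltrMax-0 (_ ∷ _) (_ , () , _)

ltrMax-1 : ∀ x xs → IsLTRMax (x ∷ xs) 1
ltrMax-1 x xs = x , refl , λ { j w (s≤s z≤n) (s≤s ()) _ }

ltrMax-≤ : ∀ xs i → IsLTRMax xs i → i ≤ length xs
ltrMax-≤ xs zero    _            = z≤n
ltrMax-≤ xs (suc k) (_ , eq , _) = at-< xs k eq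

ltrMax-middle : ∀ P y E → All (_< y) P → IsLTRMax (P ++ y ∷ E) (suc (length P))
ltrMax-middle P y E P<y = y , at-middle P y E , below
  where
  below : ∀ j w → 1 ≤ j → j < suc (length P) → (P ++ y ∷ E) at j ≡ just w → w < y
  below (suc k) w _ (s≤s k<) eq = lookup P<y (at-∈ P k (trans (sym (at-++ˡ P (y ∷ E) k k<)) eq))

ltrMax⇒prefix< : ∀ P y E → IsLTRMax (P ++ y ∷ E) (suc (length P)) → All (_< y) P
ltrMax⇒prefix< P y E (v , at-v , below) with trans (sym (at-middle P y E)) at-v
... | refl = tabulate λ x∈P → let (k , k< , eq) = ∈⇒at P x∈P in
  below (suc k) _ (s≤s z≤n) (s≤s k<) (trans (at-++ˡ P (y ∷ E) k k<) eq)

ltrMax-++⁺ : ∀ xs τ i → IsLTRMax xs i → IsLTRMax (xs ++ τ) i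
ltrMax-++⁺ xs τ zero    l = ⊥-elim (ltrMax-0 xs l)
ltrMax-++⁺ xs τ (suc k) l@(v , eq , below) =
  v , trans (at-++ˡ xs τ k (ltrMax-≤ xs (suc k) l)) eq ,
  λ { (suc j) w _ j<k eqw →
        below (suc j) w (s≤s z≤n) j<k (trans (sym (at-++ˡ xs τ j (<-trans (≤-pred j<k) (ltrMax-≤ xs (suc k) l)))) eqw) }

ltrMax-++⁻ : ∀ xs τ i → i ≤ length xs → IsLTRMax (xs ++ τ) i → IsLTRMax xs i
ltrMax-++⁻ xs τ zero    _   l = ⊥-elim (ltrMax-0 (xs ++ τ) l)
ltrMax-++⁻ xs τ (suc k) k<n (v , eq , below) =
  v , trans (sym (at-++ˡ xs τ k k<n)) eq ,
  λ { (suc j) w _ j<k eqw → below (suc j) w (s≤s z≤n) j<k (trans (at-++ˡ xs τ j (<-trans (≤-pred j<k) k<n)) eqw) }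

ltrMax-map : ∀ (f : ℕ → ℕ) → (∀ {x y} → x < y ⇔ f x < f y) → ∀ xs i → IsLTRMax (map f xs) i ⇔ IsLTRMax xs i
ltrMax-map f f-< xs i = mk⇔ to from
  where
  to : IsLTRMax (map f xs) i → IsLTRMax xs i
  to (_ , eq , below) with map-just⁻ {f} (trans (sym (at-map f xs i)) eq)
  ... | u , eqᵤ , refl = u , eqᵤ , λ j w 1≤j j<i eqw →
    Equivalence.from (f-< {w} {u}) (below j (f w) 1≤j j<i (trans (at-map f xs j) (cong (Maybe.map f) eqw)))
  from : IsLTRMax xs i → IsLTRMax (map f xs) i
  from (u , eqᵤ , below) = f u , trans (at-map f xs i) (cong (Maybe.map f) eqᵤ) , λ j w 1≤j j<i eqw →
    let (w′ , eqw′ , fw′≡w) = map-just⁻ {f} (trans (sym (at-map f xs j)) eqw)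
    in subst (_< f u) fw′≡w (Equivalence.to f-< (below j w′ 1≤j j<i eqw′))

record AdjacentMaxima (π : List ℕ) : Set where
  constructor adjacentMaxima
  field
    prefix        : List ℕ
    first second  : ℕ
    suffix        : List ℕ
    shape         : π ≡ prefix ++ first ∷ second ∷ suffix
    prefix<first  : All (_< first) prefix
    first<second  : first < second

open AdjacentMaxima

adjacentMaxima⇒ltrMax : ∀ {π} (a : AdjacentMaxima π) →
  IsLTRMax π (suc (length (prefix a))) × IsLTRMax π (suc (suc (length (prefix a))))
adjacentMaxima⇒ltrMax (adjacentMaxima P m y E refl P<m m<y) =
  ltrMax-middle P m (y ∷ E) P<m ,
  subst₂ IsLTRMax (++-assoc P [ m ] (y ∷ E)) (cong suc (trans (length-++ P) (+-comm (length P) 1)))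
    (ltrMax-middle (P ++ [ m ]) y E (All.++⁺ (All.map (λ p<m → <-trans p<m m<y) P<m) (m<y ∷ [])))

ltrMax⇒adjacentMaxima : ∀ π k → IsLTRMax π (suc k) → IsLTRMax π (suc (suc k)) →
  Σ (AdjacentMaxima π) λ a → length (prefix a) ≡ k
ltrMax⇒adjacentMaxima π k l@(m , at-m , _) (y , at-y , below-y) with at-split π k at-m
... | P , R , refl , refl = next R refl (trans (sym (at-next P R)) at-y)
  where
  at-next : ∀ P R → (P ++ m ∷ R) at suc (suc (length P)) ≡ R at 1
  at-next []      []      = refl
  at-next []      (r ∷ R) = refl
  at-next (p ∷ P) R       = at-next P R
  next : ∀ R′ → R′ ≡ R → R′ at 1 ≡ just y → Σ (AdjacentMaxima (P ++ m ∷ R)) λ a → length (prefix a) ≡ length P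
  next (r ∷ E) refl refl =
    adjacentMaxima P m y E refl (ltrMax⇒prefix< P m R l) (below-y (suc (length P)) m (s≤s z≤n) ≤-refl at-m) , refl

NoLateAdjacentMaxima : List ℕ → Set
NoLateAdjacentMaxima π = ∀ i → 2 ≤ i → ¬ (IsLTRMax π i × IsLTRMax π (suc i))

noLate⇒prefix≡[] : ∀ {π} → NoLateAdjacentMaxima π → (a : AdjacentMaxima π) → prefix a ≡ []
noLate⇒prefix≡[] noLate a with prefix a in eq
... | []    = refl
... | _ ∷ _ = ⊥-elim (noLate (suc (length (prefix a))) (subst (λ P → 2 ≤ suc (length P)) (sym eq) (s≤s (s≤s z≤n)))
                              (adjacentMaxima⇒ltrMax a))

prefix≡[]⇒noLate : ∀ {π} → ((a : AdjacentMaxima π) → prefix a ≡ []) → NoLateAdjacentMaxima π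
prefix≡[]⇒noLate {π} early (suc k) (s≤s 1≤k) (lᵢ , lᵢ₊₁) with ltrMax⇒adjacentMaxima π k lᵢ lᵢ₊₁
... | a , len≡k with prefix a | early a
...   | [] | refl = <-irrefl len≡k 1≤k

noLate-map : ∀ (f : ℕ → ℕ) → (∀ {x y} → x < y ⇔ f x < f y) → ∀ xs →
  NoLateAdjacentMaxima (map f xs) ⇔ NoLateAdjacentMaxima xs
noLate-map f f-< xs = mk⇔
  (λ noLate i 2≤i (lᵢ , lᵢ₊₁) → noLate i 2≤i (from (same i) lᵢ , from (same (suc i)) lᵢ₊₁))
  (λ noLate i 2≤i (lᵢ , lᵢ₊₁) → noLate i 2≤i (to (same i) lᵢ , to (same (suc i)) lᵢ₊₁))
  where
  open Equivalence
  same = ltrMax-map f f-< xs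

noLate-snoc⇔ : ∀ xs y → 2 ≤ length xs →
  NoLateAdjacentMaxima (xs ++ [ y ]) ⇔
  (NoLateAdjacentMaxima xs × ¬ (IsLTRMax xs (length xs) × IsLTRMax (xs ++ [ y ]) (suc (length xs))))
noLate-snoc⇔ xs y 2≤n = mk⇔
  (λ noLate → (λ i 2≤i (lᵢ , lᵢ₊₁) → noLate i 2≤i (ltrMax-++⁺ xs _ i lᵢ , ltrMax-++⁺ xs _ (suc i) lᵢ₊₁)) ,
              (λ (lₙ , lₙ₊₁) → noLate (length xs) 2≤n (ltrMax-++⁺ xs _ _ lₙ , lₙ₊₁)))
  (λ (noLate , notLast) i 2≤i (lᵢ , lᵢ₊₁) → case-position noLate notLast i 2≤i lᵢ lᵢ₊₁
     (m≤n⇒m<n∨m≡n (≤-pred (subst (suc i ≤_) (length-snoc xs y) (ltrMax-≤ (xs ++ [ y ]) (suc i) lᵢ₊₁)))))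
  where
  case-position : NoLateAdjacentMaxima xs → ¬ (IsLTRMax xs (length xs) × IsLTRMax (xs ++ [ y ]) (suc (length xs))) →
    ∀ i → 2 ≤ i → IsLTRMax (xs ++ [ y ]) i → IsLTRMax (xs ++ [ y ]) (suc i) → i < length xs ⊎ i ≡ length xs → ⊥
  case-position noLate _ i 2≤i lᵢ lᵢ₊₁ (inj₁ i<n) =
    noLate i 2≤i (ltrMax-++⁻ xs _ i (<⇒≤ i<n) lᵢ , ltrMax-++⁻ xs _ (suc i) i<n lᵢ₊₁)
  case-position _ notLast i _ lᵢ lᵢ₊₁ (inj₂ refl) = notLast (ltrMax-++⁻ xs _ i ≤-refl lᵢ , lᵢ₊₁)

-- Permutations of 1, …, n

Unique-↭ : ∀ {xs ys : List ℕ} → xs ↭ ys → Unique xs → Unique ys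
Unique-↭ p = Perm.Unique-resp-↭ (setoid ℕ) (↭⇒↭ₛ p)

Unique-range : ∀ n → Unique (map suc (upTo n))
Unique-range n = Unique.map⁺ suc-injective (Unique.upTo⁺ n)

Unique-snoc : ∀ (I : List ℕ) {x} → Unique (I ++ [ x ]) → All (_≢ x) I
Unique-snoc []      _            = []
Unique-snoc (i ∷ I) (i∉ ∷ u) with All.++⁻ʳ I i∉
... | i≢x ∷ [] = i≢x ∷ Unique-snoc I u

∈-range⁻ : ∀ {n x} → x ∈ map suc (upTo n) → 1 ≤ x × x ≤ n
∈-range⁻ x∈ with ∈-map⁻ suc x∈
... | _ , y∈ , refl = s≤s z≤n , ∈-upTo⁻ y∈

∈-range⁺ : ∀ {n x} → 1 ≤ x → x ≤ n → x ∈ map suc (upTo n)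
∈-range⁺ {x = suc x} _ x<n = ∈-map⁺ suc (∈-upTo⁺ x<n)

isPerm-unique : ∀ {n σ} → IsPerm n σ → Unique σ
isPerm-unique {n} p = Unique-↭ (↭-sym p) (Unique-range n)

isPerm-∈⁻ : ∀ {n σ x} → IsPerm n σ → x ∈ σ → 1 ≤ x × x ≤ n
isPerm-∈⁻ p x∈ = ∈-range⁻ (∈-resp-↭ p x∈)

isPerm-∈⁺ : ∀ {n σ x} → IsPerm n σ → 1 ≤ x → x ≤ n → x ∈ σ
isPerm-∈⁺ p 1≤x x≤n = ∈-resp-↭ (↭-sym p) (∈-range⁺ 1≤x x≤n)

isPerm-positive : ∀ {n σ} → IsPerm n σ → All (0 <_) σ
isPerm-positive p = tabulate λ x∈ → proj₁ (isPerm-∈⁻ p x∈)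

isPerm-length : ∀ {n σ} → IsPerm n σ → length σ ≡ n
isPerm-length {n} p = trans (↭-length p) (trans (length-map suc (upTo n)) (length-upTo n))

isPerm-intro : ∀ n σ → Unique σ → (∀ {x} → x ∈ σ → 1 ≤ x × x ≤ n) → (∀ {x} → 1 ≤ x → x ≤ n → x ∈ σ) →
               IsPerm n σ
isPerm-intro n σ u inside onto = ∼bag⇒↭ (unique∧set⇒bag u (Unique-range n)
  (mk⇔ (λ x∈ → let (1≤x , x≤n) = inside x∈ in ∈-range⁺ 1≤x x≤n)
       (λ x∈ → let (1≤x , x≤n) = ∈-range⁻ x∈ in onto 1≤x x≤n)))

isPerm-nonempty : ∀ {n σ} → 1 ≤ n → IsPerm n σ → Σ ℕ λ m → Σ (List ℕ) λ rest → σ ≡ m ∷ rest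
isPerm-nonempty {σ = []}       1≤n p with () ← isPerm-∈⁺ p 1≤n ≤-refl
isPerm-nonempty {σ = m ∷ rest} 1≤n p = m , rest , refl

isPerm-endsWithMax : ∀ {n M σ} → 1 ≤ n → IsPerm n σ → EndsWithMax M σ → M ≡ n
isPerm-endsWithMax 1≤n p endsM@(J , refl , _) =
  ≤-antisym (proj₂ (isPerm-∈⁻ p (∈-++⁺ʳ J (here refl)))) (endsWithMax-≤ endsM (isPerm-∈⁺ p 1≤n ≤-refl))

isPerm-snoc-endsWithMax : ∀ {n} I → IsPerm n (I ++ [ n ]) → EndsWithMax n (I ++ [ n ])
isPerm-snoc-endsWithMax I p = I , refl , All.zipWith (λ (x≤n , x≢n) → ≤∧≢⇒< x≤n x≢n)
  (tabulate (λ x∈I → proj₂ (isPerm-∈⁻ p (∈-++⁺ˡ x∈I))) , Unique-snoc I (isPerm-unique p))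

isPerm-snoc-length : ∀ {n x} I → IsPerm n (I ++ [ x ]) → suc (length I) ≡ n
isPerm-snoc-length {x = x} I p = trans (sym (length-snoc I x)) (isPerm-length p)

endsWithMax? : ∀ {n} π → IsPerm n π → Dec (EndsWithMax n π)
endsWithMax? {n} π p with initLast π
... | []      = no λ { (J , eq , _) → ∷ʳ-≢-[] J (sym eq) }
  where
  ∷ʳ-≢-[] : ∀ (J : List ℕ) → J ++ [ n ] ≢ []
  ∷ʳ-≢-[] []      ()
  ∷ʳ-≢-[] (_ ∷ _) ()
... | I ∷ʳ′ z with z ≟ n
...   | yes refl = yes (isPerm-snoc-endsWithMax I p)
...   | no  z≢n  = no λ { (J , eq , _) → z≢n (∷ʳ-injectiveʳ I J eq) }

endsWithMax⇒at : ∀ {n π} → IsPerm n π → EndsWithMax n π → π at n ≡ just n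
endsWithMax⇒at {n} p (J , refl , _) = subst (λ i → (J ++ [ n ]) at i ≡ just n) (isPerm-snoc-length J p) (at-middle J n [])

endsWithMax⇒ltrMax : ∀ {n π} → IsPerm n π → EndsWithMax n π → IsLTRMax π n
endsWithMax⇒ltrMax {n} p (J , refl , J<n) = subst (IsLTRMax (J ++ [ n ])) (isPerm-snoc-length J p) (ltrMax-middle J n [] J<n)

at⇒endsWithMax : ∀ {k π} → IsPerm (suc k) π → π at suc k ≡ just (suc k) → EndsWithMax (suc k) π
at⇒endsWithMax {k} {π} p eq with at-last⁻ π k (isPerm-length p) eq
... | I , refl , _ = isPerm-snoc-endsWithMax I p

ltrMax⇒endsWithMax : ∀ {k π} → IsPerm (suc k) π → IsLTRMax π (suc k) → EndsWithMax (suc k) π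
ltrMax⇒endsWithMax {k} {π} p l@(v , eq , _) with at-last⁻ π k (isPerm-length p) eq
... | I , refl , refl with ltrMax⇒prefix< I v [] l
... | I<v with isPerm-endsWithMax (s≤s z≤n) p (I , refl , I<v)
... | refl = I , refl , I<v

-- The characterization

q-endsWith-n : ∀ {n σ} → 1 ≤ n → IsPerm n σ → EndsWithMax n (q σ)
q-endsWith-n {n} {σ} 1≤n p with isPerm-nonempty 1≤n p
... | m , rest , refl with q-endsWithMax (length σ) σ ≤-refl (isPerm-unique p) (isPerm-positive p) (λ ())
... | M , endsM with isPerm-endsWithMax 1≤n (↭-trans (q-↭ σ) p) endsM
... | refl = endsM

preimage-isPerm : ∀ {n π σ} → IsPerm n π → q σ ≡ π → IsPerm n σ
preimage-isPerm {σ = σ} p refl = ↭-trans (↭-sym (q-↭ σ)) p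

-- For nonempty P the three preimages are distinct; for P = [] the last two coincide.
preimages : ∀ {n m} P R → 0 < m → All (_< m) P → HeadAbove m (R ++ [ n ]) → All (_< n) (P ++ m ∷ R) →
  q (n ∷ P ++ m ∷ R) ≡ P ++ m ∷ R ++ [ n ] × q (m ∷ n ∷ P ++ R) ≡ P ++ m ∷ R ++ [ n ] ×
  q (m ∷ P ++ n ∷ R) ≡ P ++ m ∷ R ++ [ n ]
preimages {n} {m} P R 0<m P<m m<R+n below-n =
  trans (q-last n (P ++ m ∷ R) 0<n below-n) (++-assoc P (m ∷ R) [ n ]) ,
  (begin
    q (m ∷ n ∷ P ++ R)       ≡⟨ q-block m [] (n ∷ P ++ R) 0<m [] m<n ⟩
    push m (q (n ∷ P ++ R))  ≡⟨ cong (push m) (trans (q-last n (P ++ R) 0<n (All.++⁺ P<n R<n)) (++-assoc P R [ n ])) ⟩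
    push m (P ++ R ++ [ n ]) ≡⟨ push-++ m P _ P<m ⟩
    P ++ push m (R ++ [ n ]) ≡⟨ m-stays ⟩
    P ++ m ∷ R ++ [ n ]      ∎) ,
  (begin
    q (m ∷ P ++ n ∷ R)       ≡⟨ q-block m P (n ∷ R) 0<m P<m m<n ⟩
    P ++ push m (q (n ∷ R))  ≡⟨ cong (λ τ → P ++ push m τ) (q-last n R 0<n R<n) ⟩
    P ++ push m (R ++ [ n ]) ≡⟨ m-stays ⟩
    P ++ m ∷ R ++ [ n ]      ∎)
  where
  open ≡-Reasoning
  P<n : All (_< n) P
  P<n = All.++⁻ˡ P below-n
  m<n : m < n
  m<n = lookup below-n (∈-++⁺ʳ P (here refl))
  R<n : All (_< n) R
  R<n with All.++⁻ʳ P below-n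
  ... | _ ∷ R<n = R<n
  0<n : 0 < n
  0<n = <-trans 0<m m<n
  m-stays : P ++ push m (R ++ [ n ]) ≡ P ++ m ∷ R ++ [ n ]
  m-stays = cong (P ++_) (push-headAbove (R ++ [ n ]) m<R+n)

noThirdPreimage : ∀ {n π σ₁ σ₂} → IsPerm n π → (∀ σ → IsPerm n σ → q σ ≡ π → σ ≡ σ₁ ⊎ σ ≡ σ₂) →
  ∀ {τ₁ τ₂ τ₃} → q τ₁ ≡ π → q τ₂ ≡ π → q τ₃ ≡ π → τ₁ ≢ τ₂ → τ₁ ≢ τ₃ → τ₂ ≢ τ₃ → ⊥
noThirdPreimage p only {τ₁} {τ₂} {τ₃} eq₁ eq₂ eq₃ d₁₂ d₁₃ d₂₃
  with only τ₁ (preimage-isPerm p eq₁) eq₁ | only τ₂ (preimage-isPerm p eq₂) eq₂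
     | only τ₃ (preimage-isPerm p eq₃) eq₃
... | inj₁ refl | inj₁ refl | _         = d₁₂ refl
... | inj₂ refl | inj₂ refl | _         = d₁₂ refl
... | inj₁ refl | inj₂ refl | inj₁ refl = d₁₃ refl
... | inj₁ refl | inj₂ refl | inj₂ refl = d₂₃ refl
... | inj₂ refl | inj₁ refl | inj₁ refl = d₂₃ refl
... | inj₂ refl | inj₁ refl | inj₂ refl = d₁₃ refl

adjacentMaxima-endsWithMax : ∀ {n π} → EndsWithMax n π → (a : AdjacentMaxima π) →
  Σ (List ℕ) λ R → π ≡ prefix a ++ first a ∷ R ++ [ n ] × HeadAbove (first a) (R ++ [ n ]) ×
                   All (_< n) (prefix a ++ first a ∷ R)
adjacentMaxima-endsWithMax {n} (I , eqI , I<n) (adjacentMaxima P m y E refl _ m<y) with snoc-view (y ∷ E) (λ ())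
... | R , z , eqR
  with ∷ʳ-injective (P ++ m ∷ R) I (trans (++-assoc P (m ∷ R) [ z ]) (trans (cong (λ τ → P ++ m ∷ τ) (sym eqR)) eqI))
... | refl , refl = R , cong (λ τ → P ++ m ∷ τ) eqR , subst (HeadAbove m) eqR m<y , I<n

twoPreimages⇒noLate : ∀ {n π} → IsPerm n π → EndsWithMax n π → HasTwoPreimages n π → NoLateAdjacentMaxima π
twoPreimages⇒noLate {n} {π} pπ endsN (_ , _ , _ , _ , _ , _ , _ , only) = prefix≡[]⇒noLate early
  where
  early : (a : AdjacentMaxima π) → prefix a ≡ []
  early (adjacentMaxima [] _ _ _ _ _ _) = refl
  early a@(adjacentMaxima (p ∷ P) m y E _ (p<m ∷ P<m) _) with adjacentMaxima-endsWithMax endsN a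
  ... | R , eqπ , m<R+n , below-n = ⊥-elim (noThirdPreimage pπ only
         (trans eq₀ (sym eqπ)) (trans eq₁ (sym eqπ)) (trans eq₂ (sym eqπ))
         (λ eq → <-irrefl (sym (proj₁ (∷-injective eq))) m<n) (λ eq → <-irrefl (sym (proj₁ (∷-injective eq))) m<n)
         (λ eq → <-irrefl (sym (proj₁ (∷-injective (proj₂ (∷-injective eq))))) (<-trans p<m m<n)))
    where
    m<n : m < n
    m<n = lookup below-n (∈-++⁺ʳ (p ∷ P) (here refl))
    0<m : 0 < m
    0<m = lookup (isPerm-positive pπ) (subst (m ∈_) (sym eqπ) (∈-++⁺ʳ (p ∷ P) (here refl)))
    eqs = preimages (p ∷ P) R 0<m (p<m ∷ P<m) m<R+n below-n
    eq₀ = proj₁ eqs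
    eq₁ = proj₁ (proj₂ eqs)
    eq₂ = proj₂ (proj₂ eqs)

early⇒ltrMax-2 : ∀ {π} → NoLateAdjacentMaxima π → AdjacentMaxima π → IsLTRMax π 2
early⇒ltrMax-2 {π} noLate a =
  subst (λ P → IsLTRMax π (suc (suc (length P)))) (noLate⇒prefix≡[] noLate a) (proj₂ (adjacentMaxima⇒ltrMax a))

-- Two distinct preimages cannot both move their first entry to the end.
twoPreimages⇒ltrMax-2 : ∀ {n π} → NoLateAdjacentMaxima π → HasTwoPreimages n π → IsLTRMax π 2
twoPreimages⇒ltrMax-2 noLate (m₁ ∷ r₁ , m₂ ∷ r₂ , p₁ , p₂ , σ₁≢σ₂ , eq₁ , eq₂ , _)
  with headCase m₁ r₁ (isPerm-unique p₁) (isPerm-positive p₁) | headCase m₂ r₂ (isPerm-unique p₂) (isPerm-positive p₂)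
... | stopsBefore P y E eq P<m m<y | _ = early⇒ltrMax-2 noLate (adjacentMaxima P m₁ y E (trans (sym eq₁) eq) P<m m<y)
... | goesLast _ | stopsBefore P y E eq P<m m<y = early⇒ltrMax-2 noLate (adjacentMaxima P m₂ y E (trans (sym eq₂) eq) P<m m<y)
... | goesLast eq | goesLast eq′ with ∷ʳ-injective r₁ r₂ (trans (sym eq) (trans eq₁ (trans (sym eq₂) eq′)))
...   | refl , refl = ⊥-elim (σ₁≢σ₂ refl)
twoPreimages⇒ltrMax-2 noLate ([] , _ , p₁ , p₂ , σ₁≢σ₂ , _) =
  ⊥-elim (σ₁≢σ₂ (sym (↭-empty-inv (↭-trans p₂ (↭-sym p₁)))))
twoPreimages⇒ltrMax-2 noLate (_ ∷ _ , [] , p₁ , p₂ , σ₁≢σ₂ , _) =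
  ⊥-elim (σ₁≢σ₂ (↭-empty-inv (↭-trans p₁ (↭-sym p₂))))

q2⇒char : ∀ {n π} → 1 ≤ n → Q2 n π → Char n π
q2⇒char {n} {π} 1≤n (pπ , two@(σ₁ , _ , p₁ , _ , _ , eq₁ , _)) with subst (EndsWithMax n) eq₁ (q-endsWith-n 1≤n p₁)
... | endsN@(J , refl , _) = pπ , endsWithMax⇒at pπ endsN , ltrMax-1-snoc J , twoPreimages⇒ltrMax-2 noLate two , noLate
  where
  noLate = twoPreimages⇒noLate pπ endsN two
  ltrMax-1-snoc : ∀ J → IsLTRMax (J ++ [ n ]) 1
  ltrMax-1-snoc []      = ltrMax-1 n []
  ltrMax-1-snoc (j ∷ J) = ltrMax-1 j (J ++ [ n ])

ltrMax-2⇒headAbove : ∀ {a} τ → IsLTRMax (a ∷ τ) 2 → HeadAbove a τ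
ltrMax-2⇒headAbove []      (_ , () , _)
ltrMax-2⇒headAbove (t ∷ τ) (_ , refl , below) = below 1 _ (s≤s z≤n) (s≤s (s≤s z≤n)) refl

headAbove-< : ∀ {a m} P F → HeadAbove a (P ++ m ∷ F) → All (_< m) P → a < m
headAbove-< []      F a<m []          = a<m
headAbove-< (p ∷ P) F a<p (p<m ∷ _)   = <-trans a<p p<m

preimage-of-tail : ∀ {a n W} → NoLateAdjacentMaxima (a ∷ W ++ [ n ]) → HeadAbove a (W ++ [ n ]) →
  ∀ σ → Unique σ → All (0 <_) σ → q σ ≡ W ++ [ n ] → σ ≡ n ∷ W
preimage-of-tail {W = []}    _ _ [] _ _ ()
preimage-of-tail {W = _ ∷ _} _ _ [] _ _ ()
preimage-of-tail {a} {n} {W} noLate a<τ (m ∷ rest) u pos eq with headCase m rest u pos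
... | goesLast eq′ with ∷ʳ-injective rest W (trans (sym eq′) eq)
...   | refl , refl = refl
preimage-of-tail {a} {n} {W} noLate a<τ (m ∷ rest) u pos eq | stopsBefore P y E eq′ P<m m<y
  with noLate⇒prefix≡[] noLate (adjacentMaxima (a ∷ P) m y E (cong (a ∷_) (trans (sym eq) eq′)) (a<m ∷ P<m) m<y)
  where a<m = headAbove-< P (y ∷ E) (subst (HeadAbove a) (trans (sym eq) eq′) a<τ) P<m
... | ()

twoPreimages-of-char : ∀ {a n W} → NoLateAdjacentMaxima (a ∷ W ++ [ n ]) → HeadAbove a (W ++ [ n ]) →
  ∀ σ → Unique σ → All (0 <_) σ → q σ ≡ a ∷ W ++ [ n ] → σ ≡ n ∷ a ∷ W ⊎ σ ≡ a ∷ n ∷ W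
twoPreimages-of-char noLate a<τ [] _ _ ()
twoPreimages-of-char noLate a<τ (m ∷ rest) u pos eq with headCase m rest u pos
... | goesLast eq′ with ∷ʳ-injective rest (_ ∷ _) (trans (sym eq′) eq)
...   | refl , refl = inj₁ refl
twoPreimages-of-char noLate a<τ (m ∷ rest) u@(_ ∷ u′) pos@(_ ∷ pos′) eq | stopsBefore P y E eq′ P<m m<y
  with noLate⇒prefix≡[] noLate (adjacentMaxima P m y E (trans (sym eq) eq′) P<m m<y)
... | refl with ∷-injective (trans (sym eq′) eq)
...   | refl , eqτ = inj₂ (cong (_ ∷_) (preimage-of-tail noLate a<τ rest u′ pos′ (trans (q-headFixed u pos eq′) eqτ)))

char⇒q2 : ∀ {k π} → Char (suc k) π → Q2 (suc k) π
char⇒q2 {k} (pπ , atn , _ , l₂ , noLate) with at⇒endsWithMax pπ atn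
... | [] , refl , _ with () ← proj₁ (proj₂ l₂)
... | a ∷ W , refl , a<n ∷ W<n =
  pπ , n ∷ a ∷ W , a ∷ n ∷ W , preimage-isPerm pπ eq₀ , preimage-isPerm pπ eq₁ ,
  (λ eq → <-irrefl (sym (proj₁ (∷-injective eq))) a<n) , eq₀ , eq₁ ,
  λ σ p eq → twoPreimages-of-char noLate a<τ σ (isPerm-unique p) (isPerm-positive p) eq
  where
  n = suc k
  a<τ : HeadAbove a (W ++ [ n ])
  a<τ = ltrMax-2⇒headAbove (W ++ [ n ]) l₂
  eqs = preimages [] W (lookup (isPerm-positive pπ) (here refl)) [] a<τ (a<n ∷ W<n)
  eq₀ = proj₁ eqs
  eq₁ = proj₁ (proj₂ eqs)

characterization : (n : ℕ) → 1 ≤ n → (π : List ℕ) → Q2 n π ⇔ Char n π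
characterization (suc k) 1≤n π = mk⇔ (q2⇒char 1≤n) char⇒q2

-- Appending a new last entry

-- ext inverts deleting the last entry and standardizing the rest.
bump : ℕ → ℕ → ℕ
bump v x = if x <ᵇ v then x else suc x

ext : ℕ → List ℕ → List ℕ
ext v ρ = map (bump v) ρ ++ [ v ]

bump-< : ∀ {v x} → x < v → bump v x ≡ x
bump-< {v} {x} x<v rewrite dec-true (x <? v) x<v = refl

bump-≥ : ∀ {v x} → v ≤ x → bump v x ≡ suc x
bump-≥ {v} {x} v≤x rewrite dec-false (x <? v) (≤⇒≯ v≤x) = refl

bump-≢ : ∀ v x → bump v x ≢ v
bump-≢ v x with x <? v
... | yes x<v = λ eq → <-irrefl (trans (sym (bump-< x<v)) eq) x<v
... | no  x≮v = λ eq → <-irrefl (trans (sym eq) (bump-≥ (≮⇒≥ x≮v))) (s≤s (≮⇒≥ x≮v))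

bump-mono : ∀ v {x y} → x < y → bump v x < bump v y
bump-mono v {x} {y} x<y with x <? v | y <? v
... | yes x<v | yes y<v rewrite bump-< x<v | bump-< y<v = x<y
... | yes x<v | no  y≮v rewrite bump-< x<v | bump-≥ (≮⇒≥ y≮v) = <-trans x<y (n<1+n y)
... | no  x≮v | yes y<v = ⊥-elim (x≮v (<-trans x<y y<v))
... | no  x≮v | no  y≮v rewrite bump-≥ (≮⇒≥ x≮v) | bump-≥ (≮⇒≥ y≮v) = s≤s x<y

bump-<⇔ : ∀ v {x y} → x < y ⇔ bump v x < bump v y
bump-<⇔ v {x} {y} = mk⇔ (bump-mono v) reflect
  where
  reflect : bump v x < bump v y → x < y
  reflect bx<by with <-cmp x y
  ... | tri< x<y _ _ = x<y
  ... | tri≈ _ refl _ = ⊥-elim (<-irrefl refl bx<by)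
  ... | tri> _ _ y<x = ⊥-elim (<-asym bx<by (bump-mono v y<x))

bump-injective : ∀ v {x y} → bump v x ≡ bump v y → x ≡ y
bump-injective v {x} {y} eq with <-cmp x y
... | tri< x<y _ _ = ⊥-elim (<-irrefl eq (bump-mono v x<y))
... | tri≈ _ x≡y _ = x≡y
... | tri> _ _ y<x = ⊥-elim (<-irrefl (sym eq) (bump-mono v y<x))

bump-range : ∀ {n v x} → 1 ≤ v → 1 ≤ x → x ≤ n → 1 ≤ bump v x × bump v x ≤ suc n
bump-range {v = v} {x} 1≤v 1≤x x≤n with x <? v
... | yes x<v rewrite bump-< x<v = 1≤x , m≤n⇒m≤1+n x≤n
... | no  x≮v rewrite bump-≥ (≮⇒≥ x≮v) = s≤s z≤n , s≤s x≤n

ext-injective : ∀ {v v′ ρ ρ′} → ext v ρ ≡ ext v′ ρ′ → v ≡ v′ × ρ ≡ ρ′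
ext-injective {v} {v′} {ρ} {ρ′} eq with ∷ʳ-injective (map (bump v) ρ) (map (bump v′) ρ′) eq
... | eq′ , refl = refl , map-injective (bump-injective v) eq′

isPerm-ext : ∀ {n v ρ} → IsPerm n ρ → 1 ≤ v → v ≤ suc n → IsPerm (suc n) (ext v ρ)
isPerm-ext {n} {v} {ρ} p 1≤v v≤1+n = isPerm-intro (suc n) (ext v ρ) unique inside onto
  where
  unique : Unique (ext v ρ)
  unique = Unique.++⁺ (Unique.map⁺ (bump-injective v) (isPerm-unique p)) ([] ∷ [])
    λ { (x∈ , here refl) → let (y , _ , eq) = ∈-map⁻ (bump v) x∈ in bump-≢ v y (sym eq) }
  inside : ∀ {x} → x ∈ ext v ρ → 1 ≤ x × x ≤ suc n
  inside x∈ with ∈-++⁻ (map (bump v) ρ) x∈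
  ... | inj₂ (here refl) = 1≤v , v≤1+n
  ... | inj₁ x∈map with ∈-map⁻ (bump v) x∈map
  ...   | y , y∈ρ , refl = let (1≤y , y≤n) = isPerm-∈⁻ p y∈ρ in bump-range 1≤v 1≤y y≤n
  onto : ∀ {x} → 1 ≤ x → x ≤ suc n → x ∈ ext v ρ
  onto {x} 1≤x x≤1+n with <-cmp x v
  ... | tri≈ _ refl _ = ∈-++⁺ʳ _ (here refl)
  ... | tri< x<v _ _  = ∈-++⁺ˡ (subst (_∈ map (bump v) ρ) (bump-< x<v)
                          (∈-map⁺ (bump v) (isPerm-∈⁺ p 1≤x (≤-pred (≤-trans x<v v≤1+n)))))
  onto {suc y} _ (s≤s y≤n) | tri> _ _ v<x = ∈-++⁺ˡ (subst (_∈ map (bump v) ρ) (bump-≥ (≤-pred v<x))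
                          (∈-map⁺ (bump v) (isPerm-∈⁺ p (≤-trans 1≤v (≤-pred v<x)) y≤n)))

unbump : ∀ v (I : List ℕ) → All (_≢ v) I → All (0 <_) I → Σ (List ℕ) λ ρ → map (bump v) ρ ≡ I
unbump v []      []          []        = [] , refl
unbump v (x ∷ I) (x≢v ∷ I≢v) (0<x ∷ pos) with unbump v I I≢v pos | <-cmp x v
... | ρ , eq | tri< x<v _ _   = x ∷ ρ , cong₂ _∷_ (bump-< x<v) eq
... | ρ , eq | tri≈ _ x≡v _   = ⊥-elim (x≢v x≡v)
unbump v (suc y ∷ I) _ _ | ρ , eq | tri> _ _ v<x = y ∷ ρ , cong₂ _∷_ (bump-≥ (≤-pred v<x)) eq

ext-surjective : ∀ {n π} → IsPerm (suc n) π →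
  Σ ℕ λ v → Σ (List ℕ) λ ρ → π ≡ ext v ρ × IsPerm n ρ × 1 ≤ v × v ≤ suc n
ext-surjective {n} {π} p with snoc-view π (λ { refl → 0≢1+n (↭-length p) })
... | I , v , refl with unbump v I (Unique-snoc I (isPerm-unique p)) (All.++⁻ˡ I (isPerm-positive p))
... | ρ , refl = v , ρ , refl , isPerm-intro n ρ unique inside onto , isPerm-∈⁻ p (∈-++⁺ʳ _ (here refl))
  where
  1≤v = proj₁ (isPerm-∈⁻ p (∈-++⁺ʳ _ (here refl)))
  v≤1+n = proj₂ (isPerm-∈⁻ p (∈-++⁺ʳ _ (here refl)))
  unique : Unique ρ
  unique = Unique.map⁻ (Unique-++⁻ˡ (map (bump v) ρ) (isPerm-unique p))
  inside : ∀ {x} → x ∈ ρ → 1 ≤ x × x ≤ n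
  inside {x} x∈ with isPerm-∈⁻ p (∈-++⁺ˡ (∈-map⁺ (bump v) x∈)) | x <? v
  ... | 1≤bx , bx≤1+n | yes x<v rewrite bump-< x<v = 1≤bx , ≤-pred (≤-trans x<v v≤1+n)
  ... | _    , bx≤1+n | no  x≮v rewrite bump-≥ (≮⇒≥ x≮v) = ≤-trans 1≤v (≮⇒≥ x≮v) , ≤-pred bx≤1+n
  onto : ∀ {x} → 1 ≤ x → x ≤ n → x ∈ ρ
  onto {x} 1≤x x≤n with bump-range 1≤v 1≤x x≤n
  ... | 1≤bx , bx≤1+n with ∈-++⁻ (map (bump v) ρ) (isPerm-∈⁺ p 1≤bx bx≤1+n)
  ...   | inj₂ (here bx≡v) = ⊥-elim (bump-≢ v x bx≡v)
  ...   | inj₁ bx∈ with ∈-map⁻ (bump v) bx∈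
  ...     | y , y∈ρ , eq = subst (_∈ ρ) (sym (bump-injective v eq)) y∈ρ

ltrMax-ext : ∀ v ρ i → i ≤ length ρ → IsLTRMax (ext v ρ) i ⇔ IsLTRMax ρ i
ltrMax-ext v ρ i i≤n = mk⇔
  (λ l → to (ltrMax-map (bump v) (bump-<⇔ v) ρ i) (ltrMax-++⁻ (map (bump v) ρ) _ i i≤n′ l))
  (λ l → ltrMax-++⁺ (map (bump v) ρ) _ i (from (ltrMax-map (bump v) (bump-<⇔ v) ρ i) l))
  where
  open Equivalence
  i≤n′ = subst (i ≤_) (sym (length-map (bump v) ρ)) i≤n

endsWithMax-ext : ∀ {n v ρ} → IsPerm n ρ → 1 ≤ v → v ≤ suc n → EndsWithMax (suc n) (ext v ρ) ⇔ v ≡ suc n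
endsWithMax-ext {n} {v} {ρ} p 1≤v v≤1+n = mk⇔
  (λ (J , eq , _) → ∷ʳ-injectiveʳ (map (bump v) ρ) J eq)
  (λ { refl → isPerm-snoc-endsWithMax (map (bump v) ρ) (isPerm-ext p 1≤v v≤1+n) })

Good : ℕ → List ℕ → Set
Good n π = IsPerm n π × IsLTRMax π 1 × IsLTRMax π 2 × NoLateAdjacentMaxima π

good-ext⇔ : ∀ {n v ρ} → 2 ≤ n → IsPerm n ρ → 1 ≤ v → v ≤ suc n →
  Good (suc n) (ext v ρ) ⇔ (Good n ρ × ¬ (EndsWithMax n ρ × v ≡ suc n))
good-ext⇔ {n} {v} {ρ} 2≤n@(s≤s _) p 1≤v v≤1+n = mk⇔
  (λ (_ , l₁ , l₂ , noLate) → let (noLateMap , notLast) = to (noLate-snoc⇔ bρ v 2≤len) noLate in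
     (p , to (ltrMax-ext v ρ 1 1≤len) l₁ , to (ltrMax-ext v ρ 2 2≤len′) l₂ ,
      to (noLate-map (bump v) (bump-<⇔ v) ρ) noLateMap) ,
     λ (ends , v≡1+n) → notLast (last-ρ⇐ ends , last-ext⇐ v≡1+n))
  (λ ((_ , l₁ , l₂ , noLate) , notEnds) →
     isPerm-ext p 1≤v v≤1+n , from (ltrMax-ext v ρ 1 1≤len) l₁ , from (ltrMax-ext v ρ 2 2≤len′) l₂ ,
     from (noLate-snoc⇔ bρ v 2≤len) (from (noLate-map (bump v) (bump-<⇔ v) ρ) noLate ,
       λ (lₙ , lₙ₊₁) → notEnds (last-ρ⇒ lₙ , last-ext⇒ lₙ₊₁)))
  where
  open Equivalence
  bρ = map (bump v) ρ
  len≡n : length bρ ≡ n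
  len≡n = trans (length-map (bump v) ρ) (isPerm-length p)
  2≤len : 2 ≤ length bρ
  2≤len = subst (2 ≤_) (sym len≡n) 2≤n
  1≤len : 1 ≤ length ρ
  1≤len = subst (1 ≤_) (sym (isPerm-length p)) (s≤s z≤n)
  2≤len′ : 2 ≤ length ρ
  2≤len′ = subst (2 ≤_) (sym (isPerm-length p)) 2≤n
  pE = isPerm-ext p 1≤v v≤1+n
  last-ρ⇐ : EndsWithMax n ρ → IsLTRMax bρ (length bρ)
  last-ρ⇐ ends = subst (IsLTRMax bρ) (sym len≡n) (from (ltrMax-map (bump v) (bump-<⇔ v) ρ n) (endsWithMax⇒ltrMax p ends))
  last-ρ⇒ : IsLTRMax bρ (length bρ) → EndsWithMax n ρ
  last-ρ⇒ l = ltrMax⇒endsWithMax p (to (ltrMax-map (bump v) (bump-<⇔ v) ρ n) (subst (IsLTRMax bρ) len≡n l))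
  last-ext⇐ : v ≡ suc n → IsLTRMax (ext v ρ) (suc (length bρ))
  last-ext⇐ v≡1+n = subst (λ i → IsLTRMax (ext v ρ) (suc i)) (sym len≡n)
    (endsWithMax⇒ltrMax pE (from (endsWithMax-ext p 1≤v v≤1+n) v≡1+n))
  last-ext⇒ : IsLTRMax (ext v ρ) (suc (length bρ)) → v ≡ suc n
  last-ext⇒ l = to (endsWithMax-ext p 1≤v v≤1+n) (ltrMax⇒endsWithMax pE (subst (λ i → IsLTRMax (ext v ρ) (suc i)) len≡n l))

-- Counting

Enumerates : List (List ℕ) → (List ℕ → Set) → Set
Enumerates l P = Unique l × (∀ π → π ∈ l ⇔ P π)

enumerates-++ : ∀ {L₁ L₂} {P₁ P₂ : List ℕ → Set} → Enumerates L₁ P₁ → Enumerates L₂ P₂ →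
  (∀ {π} → P₁ π → ¬ P₂ π) → Enumerates (L₁ ++ L₂) (λ π → P₁ π ⊎ P₂ π)
enumerates-++ {L₁} (u₁ , mem₁) (u₂ , mem₂) disjoint =
  Unique.++⁺ u₁ u₂ (λ (π∈₁ , π∈₂) → disjoint (to (mem₁ _) π∈₁) (to (mem₂ _) π∈₂)) ,
  λ π → mk⇔ (λ π∈ → Sum.map (to (mem₁ π)) (to (mem₂ π)) (∈-++⁻ L₁ π∈))
            (Sum.[ (λ p₁ → ∈-++⁺ˡ (from (mem₁ π) p₁)) , (λ p₂ → ∈-++⁺ʳ L₁ (from (mem₂ π) p₂)) ])
  where open Equivalence

enumerates-ext : ∀ {vs L} {P Q : List ℕ → Set} → Unique vs → Enumerates L P →
  (∀ {v ρ} → v ∈ vs → P ρ → Q (ext v ρ)) →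
  (∀ {π} → Q π → Σ ℕ λ v → Σ (List ℕ) λ ρ → v ∈ vs × P ρ × π ≡ ext v ρ) →
  Enumerates (cartesianProductWith ext vs L) Q
enumerates-ext {vs} {L} {Q = Q} uvs (uL , memL) intro elim =
  Unique.cartesianProductWith⁺ ext ext-injective uvs uL ,
  λ π → mk⇔ (λ π∈ → let (v , ρ , v∈ , ρ∈ , eq) = ∈-cartesianProductWith⁻ ext vs L π∈ in
                     subst Q (sym eq) (intro v∈ (to (memL ρ) ρ∈)))
            (λ qπ → let (v , ρ , v∈ , pρ , eq) = elim qπ in
                     subst (_∈ cartesianProductWith ext vs L) (sym eq) (∈-cartesianProductWith⁺ ext v∈ (from (memL ρ) pρ)))
  where open Equivalence

length-cartesianProductWith : ∀ {A B C : Set} (f : A → B → C) xs ys →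
  length (cartesianProductWith f xs ys) ≡ length xs * length ys
length-cartesianProductWith f []       ys = refl
length-cartesianProductWith f (x ∷ xs) ys = trans (length-++ (map (f x) ys))
  (cong₂ _+_ (length-map (f x) ys) (length-cartesianProductWith f xs ys))

GoodMaxLast GoodMaxNotLast : ℕ → List ℕ → Set
GoodMaxLast    n π = Good n π × EndsWithMax n π
GoodMaxNotLast n π = Good n π × ¬ EndsWithMax n π

-- the permutations of 1, …, k + 2 in GoodMaxLast and in GoodMaxNotLast
goodLists : ℕ → List (List ℕ) × List (List ℕ)
goodLists zero    = (1 ∷ 2 ∷ []) ∷ [] , []
goodLists (suc k) = cartesianProductWith ext [ 3 + k ] (proj₂ (goodLists k)) ,
                    cartesianProductWith ext (map suc (upTo (2 + k))) (proj₁ (goodLists k) ++ proj₂ (goodLists k))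

good-12 : GoodMaxLast 2 (1 ∷ 2 ∷ [])
good-12 = (↭-refl , ltrMax-1 1 _ , endsWithMax⇒ltrMax ↭-refl ends , noLate) , ends
  where
  ends : EndsWithMax 2 (1 ∷ 2 ∷ [])
  ends = 1 ∷ [] , refl , s≤s (s≤s z≤n) ∷ []
  noLate : NoLateAdjacentMaxima (1 ∷ 2 ∷ [])
  noLate i 2≤i (_ , lᵢ₊₁) = <-irrefl refl (≤-trans (s≤s 2≤i) (ltrMax-≤ _ (suc i) lᵢ₊₁))

goodMaxLast-2 : ∀ {π} → GoodMaxLast 2 π → π ≡ 1 ∷ 2 ∷ []
goodMaxLast-2 ((p , _) , []                , refl , _) with () ← isPerm-length p
goodMaxLast-2 ((p , _) , (_ ∷ _ ∷ J)       , refl , _)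
  with () ← trans (sym (length-snoc J 2)) (suc-injective (suc-injective (isPerm-length p)))
goodMaxLast-2 ((p , _) , (zero ∷ [])       , refl , _) with () ∷ _ ← isPerm-positive p
goodMaxLast-2 ((p , _) , (suc zero ∷ [])   , refl , _) = refl
goodMaxLast-2 ((p , _) , (suc (suc _) ∷ []) , refl , s≤s (s≤s ()) ∷ [])

goodMaxLast-enumerate : ∀ {n L} → 2 ≤ n → Enumerates L (GoodMaxNotLast n) →
  Enumerates (cartesianProductWith ext [ suc n ] L) (GoodMaxLast (suc n))
goodMaxLast-enumerate {n} 2≤n enumNotLast = enumerates-ext ([] ∷ []) enumNotLast intro elim
  where
  open Equivalence
  intro : ∀ {v ρ} → v ∈ [ suc n ] → GoodMaxNotLast n ρ → GoodMaxLast (suc n) (ext v ρ)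
  intro (here refl) (g@(p , _) , notEnds) =
    from (good-ext⇔ 2≤n p (s≤s z≤n) ≤-refl) (g , λ (ends , _) → notEnds ends) ,
    from (endsWithMax-ext p (s≤s z≤n) ≤-refl) refl
  elim : ∀ {π} → GoodMaxLast (suc n) π →
    Σ ℕ λ v → Σ (List ℕ) λ ρ → v ∈ [ suc n ] × GoodMaxNotLast n ρ × π ≡ ext v ρ
  elim (g@(p , _) , ends) with ext-surjective p
  ... | v , ρ , refl , pρ , 1≤v , v≤1+n with to (endsWithMax-ext pρ 1≤v v≤1+n) ends
  ... | refl with to (good-ext⇔ 2≤n pρ 1≤v v≤1+n) g
  ... | gρ , notLast = v , ρ , here refl , (gρ , λ endsρ → notLast (endsρ , refl)) , refl

goodMaxNotLast-enumerate : ∀ {n L₁ L₂} → 2 ≤ n → Enumerates L₁ (GoodMaxLast n) → Enumerates L₂ (GoodMaxNotLast n) →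
  Enumerates (cartesianProductWith ext (map suc (upTo n)) (L₁ ++ L₂)) (GoodMaxNotLast (suc n))
goodMaxNotLast-enumerate {n} 2≤n enumLast enumNotLast =
  enumerates-ext (Unique-range n) (enumerates-++ enumLast enumNotLast (λ (_ , ends) (_ , notEnds) → notEnds ends)) intro elim
  where
  open Equivalence
  intro : ∀ {v ρ} → v ∈ map suc (upTo n) → GoodMaxLast n ρ ⊎ GoodMaxNotLast n ρ → GoodMaxNotLast (suc n) (ext v ρ)
  intro {v} {ρ} v∈ gρ = from (good-ext⇔ 2≤n p 1≤v v≤1+n) (good , λ (_ , v≡1+n) → v≢1+n v≡1+n) ,
    λ ends → v≢1+n (to (endsWithMax-ext p 1≤v v≤1+n) ends)
    where
    1≤v = proj₁ (∈-range⁻ v∈)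
    v≤n = proj₂ (∈-range⁻ v∈)
    v≤1+n = m≤n⇒m≤1+n v≤n
    v≢1+n : v ≢ suc n
    v≢1+n v≡1+n = <-irrefl v≡1+n (s≤s v≤n)
    good : Good n ρ
    good = Sum.[ proj₁ , proj₁ ] gρ
    p = proj₁ good
  elim : ∀ {π} → GoodMaxNotLast (suc n) π →
    Σ ℕ λ v → Σ (List ℕ) λ ρ → v ∈ map suc (upTo n) × (GoodMaxLast n ρ ⊎ GoodMaxNotLast n ρ) × π ≡ ext v ρ
  elim (g@(p , _) , notEnds) with ext-surjective p
  ... | v , ρ , refl , pρ , 1≤v , v≤1+n = v , ρ , ∈-range⁺ 1≤v v≤n , classify (endsWithMax? ρ pρ) , refl
    where
    v≢1+n : v ≢ suc n
    v≢1+n v≡1+n = notEnds (from (endsWithMax-ext pρ 1≤v v≤1+n) v≡1+n)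
    v≤n : v ≤ n
    v≤n = ≤-pred (≤∧≢⇒< v≤1+n v≢1+n)
    gρ : Good n ρ
    gρ = proj₁ (to (good-ext⇔ 2≤n pρ 1≤v v≤1+n) g)
    classify : Dec (EndsWithMax n ρ) → GoodMaxLast n ρ ⊎ GoodMaxNotLast n ρ
    classify (yes ends)    = inj₁ (gρ , ends)
    classify (no  notEnds) = inj₂ (gρ , notEnds)

goodLists-enumerate : ∀ k → Enumerates (proj₁ (goodLists k)) (GoodMaxLast (2 + k)) ×
                            Enumerates (proj₂ (goodLists k)) (GoodMaxNotLast (2 + k))
goodLists-enumerate zero =
  ([] ∷ [] , λ π → mk⇔ (λ { (here refl) → good-12 }) (λ g → here (goodMaxLast-2 g))) ,
  ([] , λ π → mk⇔ (λ ()) (λ ((p , _ , l₂ , _) , notEnds) → ⊥-elim (notEnds (ltrMax⇒endsWithMax p l₂))))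
goodLists-enumerate (suc k) with goodLists-enumerate k
... | enumLast , enumNotLast =
  goodMaxLast-enumerate 2≤n enumNotLast , goodMaxNotLast-enumerate 2≤n enumLast enumNotLast
  where 2≤n = s≤s (s≤s z≤n)

char⇔goodMaxLast : ∀ {k π} → Char (suc k) π ⇔ GoodMaxLast (suc k) π
char⇔goodMaxLast = mk⇔ (λ (p , atₙ , l₁ , l₂ , noLate) → (p , l₁ , l₂ , noLate) , at⇒endsWithMax p atₙ)
                       (λ ((p , l₁ , l₂ , noLate) , ends) → p , endsWithMax⇒at p ends , l₁ , l₂ , noLate)

q2-count : ℕ → ℕ
q2-count 0             = 0
q2-count 1             = 0
q2-count (suc (suc k)) = length (proj₁ (goodLists k))

q2-hasCard : (n : ℕ) → HasCard (Q2 n) (q2-count n)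
q2-hasCard 0 = [] , refl , [] , λ π → mk⇔ (λ ())
  λ (_ , σ₁ , σ₂ , p₁ , p₂ , σ₁≢σ₂ , _) → ⊥-elim (σ₁≢σ₂ (trans (↭-empty-inv p₁) (sym (↭-empty-inv p₂))))
q2-hasCard 1 = [] , refl , [] , λ π → mk⇔ (λ ())
  λ q2 → let (p , _ , _ , l₂ , _) = q2⇒char (s≤s z≤n) q2 in
         ⊥-elim (<-irrefl refl (subst (2 ≤_) (isPerm-length p) (ltrMax-≤ π 2 l₂)))
q2-hasCard (suc (suc k)) with goodLists-enumerate k
... | (u , mem) , _ = proj₁ (goodLists k) , refl , u , λ π →
  mk⇔ (λ π∈ → from (characterization (2 + k) (s≤s z≤n) π) (from char⇔goodMaxLast (to (mem π) π∈)))
      (λ q2 → from (mem π) (to char⇔goodMaxLast (to (characterization (2 + k) (s≤s z≤n) π) q2)))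
  where open Equivalence

q2-count-recurrence : (n : ℕ) → 3 ≤ n → q2-count (suc n) ≡ (n ∸ 1) * q2-count n + (n ∸ 1) * q2-count (n ∸ 1)
q2-count-recurrence (suc (suc (suc k))) (s≤s (s≤s (s≤s _))) = begin
  length (extend [ 4 + k ] (notLast (suc k)))             ≡⟨ length-extend [ 4 + k ] (notLast (suc k)) ⟩
  length (notLast (suc k)) + 0                            ≡⟨ +-identityʳ _ ⟩
  length (extend range (last k ++ notLast k))             ≡⟨ length-extend range (last k ++ notLast k) ⟩
  length range * length (last k ++ notLast k)
    ≡⟨ cong₂ _*_ (trans (length-map suc (upTo m)) (length-upTo m)) (length-++ (last k)) ⟩
  m * (length (last k) + length (notLast k))              ≡⟨ *-distribˡ-+ m (length (last k)) _ ⟩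
  m * length (last k) + m * length (notLast k)            ≡⟨ +-comm (m * length (last k)) _ ⟩
  m * length (notLast k) + m * length (last k)            ≡⟨ cong (λ c → m * c + m * length (last k)) count-last ⟩
  m * length (last (suc k)) + m * length (last k)         ∎
  where
  open ≡-Reasoning
  m = 2 + k
  range = map suc (upTo m)
  extend : List ℕ → List (List ℕ) → List (List ℕ)
  extend = cartesianProductWith ext
  length-extend = length-cartesianProductWith ext
  last notLast : ℕ → List (List ℕ)
  last    j = proj₁ (goodLists j)
  notLast j = proj₂ (goodLists j)
  count-last : length (notLast k) ≡ length (last (suc k))
  count-last = sym (trans (length-extend [ 3 + k ] (notLast k)) (+-identityʳ _))

proposition4p8 : ((n : ℕ) → 1 ≤ n → (π : List ℕ) → Q2 n π ⇔ Char n π)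
    × Σ (ℕ → ℕ) (λ a → ((n : ℕ) → HasCard (Q2 n) (a n))
        × (a 0 ≡ 0) × (a 1 ≡ 0) × (a 3 ≡ 0) × (a 2 ≡ 1)
        × ((n : ℕ) → 3 ≤ n → a (suc n) ≡ (n ∸ 1) * a n + (n ∸ 1) * a (n ∸ 1)))
proposition4p8 = characterization , q2-count , q2-hasCard , refl , refl , refl , refl , q2-count-recurrence
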